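{- Let $P$ and $Q$ be finite posets, each of which is a disjoint union of pairwise incomparable chains. If $U_P=U_Q$, then $P$ and $Q$ are isomorphic.
   Context: A poset is a disjoint union of pairwise incomparable chains if its ground set is partitioned into blocks such that each block is totally ordered and elements in different blocks are incomparable. For a digraph $X=(V,E)$ with $|V|=n$, a $V$-listing is a bijection $\pi:[n]\to V$, and $X\mathrm{Des}(\pi)=\{i\in[n-1]:(\pi_i,\pi_{i+1})\in E\}$. Let $F_I=\sum_{i_1\le\dots\le i_n,\ i_j<i_{j+1}\ (j\in I)}x_{i_1}\cdots x_{i_n}$, and $U_X=\sum_\pi F_{X\mathrm{Des}(\pi)}$ over all $V$-listings. For a poset $P$, $U_P:=U_{D_P}$, where $D_P$ has the elements of $P$ as vertices and edges $(i,j)$ for all $i<_Pj$. -}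

module Defs where

open import Data.Nat using (ℕ; zero; suc)
open import Data.Bool using (Bool; true; false; _∧_; not; if_then_else_)
open import Data.Fin using (Fin) renaming (_≟_ to _≟ᶠ_; _<?_ to _<?ᶠ_; _≤?_ to _≤?ᶠ_)
open import Data.List using (List; []; _∷_; [_]; concatMap; map; allFin; filterᵇ; length)
open import Data.Nat.ListAction using (sum)
open import Data.Bool.ListAction using (any)
open import Data.Vec using (Vec; tabulate)
open import Data.Vec.Properties using (≡-dec)
import Data.Nat as ℕ
open import Data.Product using (Σ; _×_)
open import Data.Sum using (_⊎_)
open import Relation.Nullary using (¬_; ⌊_⌋)
open import Relation.Binary using (Decidable; IsPartialOrder)
open import Relation.Binary.PropositionalEquality using (_≡_; _≢_)
open import Function.Bundles using (_↔_; Inverse; _⇔_)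

record FinPoset : Set₁ where
  field
    size           : ℕ
    _≤_            : Fin size → Fin size → Set
    isPartialOrder : IsPartialOrder _≡_ _≤_
    _≤?_           : Decidable _≤_

record Digraph : Set where
  field
    size : ℕ
    edge : Fin size → Fin size → Bool

D : FinPoset → Digraph
D P = record { size = size ; edge = λ i j → ⌊ i ≤? j ⌋ ∧ not ⌊ i ≟ᶠ j ⌋ }
  where open FinPoset P

Isomorphic : FinPoset → FinPoset → Set
Isomorphic P Q =
  Σ (Fin (FinPoset.size P) ↔ Fin (FinPoset.size Q)) λ f →
    ∀ x y → (FinPoset._≤_ P x y ⇔ FinPoset._≤_ Q (Inverse.to f x) (Inverse.to f y))

IsDisjointUnionOfChains : FinPoset → Set
IsDisjointUnionOfChains P =
  Σ (Fin size → ℕ) λ block →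
    (∀ x y → block x ≡ block y → (x ≤ y ⊎ y ≤ x)) ×
    (∀ x y → block x ≢ block y → ¬ (x ≤ y))
  where open FinPoset P

allSeqs : ℕ → (m : ℕ) → List (List (Fin m))
allSeqs zero    m = [ [] ]
allSeqs (suc n) m = concatMap (λ s → map (_∷ s) (allFin m)) (allSeqs n m)

distinct : ∀ {m} → List (Fin m) → Bool
distinct []       = true
distinct (x ∷ xs) = not (any (λ y → ⌊ x ≟ᶠ y ⌋) xs) ∧ distinct xs

-- V-listings of V = Fin n: bijections π : [n] → V, written as the list
-- π_1 … π_n of distinct vertices.
listings : (n : ℕ) → List (List (Fin n))
listings n = filterᵇ distinct (allSeqs n n)

-- Quasisymmetric functions as coefficient functions.
-- A monomial in the variables x_1, x_2, … is x^α with α : Vec ℕ m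
-- (exponent α_k on x_{k+1}, all variables beyond x_m have exponent 0);
-- every monomial arises this way (up to trailing zeros).

-- Subsets I of the positive integers are given by characteristic
-- functions ℕ → Bool (1-indexed).

-- the sequence i_1 ≤ … ≤ i_n (variable indices, here as Fin m) with
-- i_j < i_{j+1} for j ∈ I; the natural number argument is the current
-- position j.
admissible : ∀ {m} → (ℕ → Bool) → ℕ → List (Fin m) → Bool
admissible I j (a ∷ b ∷ rest) =
  (if I j then ⌊ a <?ᶠ b ⌋ else ⌊ a ≤?ᶠ b ⌋) ∧ admissible I (suc j) (b ∷ rest)
admissible I j _ = true

-- the exponent vector of the monomial x_{i_1} ⋯ x_{i_n}
content : ∀ {m} → List (Fin m) → Vec ℕ m
content s = tabulate λ k → length (filterᵇ (λ x → ⌊ k ≟ᶠ x ⌋) s)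

-- coefficient of x^α in F_I (of degree n)
coeffF : (n : ℕ) → (ℕ → Bool) → ∀ {m} → Vec ℕ m → ℕ
coeffF n I {m} α =
  length (filterᵇ (λ s → admissible I 1 s ∧ ⌊ ≡-dec ℕ._≟_ (content s) α ⌋)
                  (allSeqs n m))

-- X Des(π) = { i ∈ [n-1] : (π_i, π_{i+1}) ∈ E }, as characteristic function
XDes : ∀ {n} → (Fin n → Fin n → Bool) → List (Fin n) → ℕ → Bool
XDes e (a ∷ b ∷ rest) (suc zero)    = e a b
XDes e (a ∷ rest)     (suc (suc i)) = XDes e (rest) (suc i)
XDes e _              _             = false

-- coefficient of x^α in U_X = Σ_π F_{X Des(π)}
coeffU : Digraph → ∀ {m} → Vec ℕ m → ℕ
coeffU X α = sum (map (λ π → coeffF size (XDes edge π) α) (listings size))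
  where open Digraph X

coeffUP : FinPoset → ∀ {m} → Vec ℕ m → ℕ
coeffUP P = coeffU (D P)

U-equal : FinPoset → FinPoset → Set
U-equal P Q = ∀ m (α : Vec ℕ m) → coeffUP P α ≡ coeffUP Q α

{-# OPTIONS --safe #-}
-- For a Boolean word T of length n − 1 let s_T be the weakly increasing sequence
-- of length n that starts at 1 and climbs by one exactly where T is true. The only
-- sequence of F_I with content x^{s_T} is s_T itself, so the coefficient is 1 if
-- I ∩ [n − 1] ⊆ T and 0 otherwise (and 0 in every other degree). Hence these
-- coefficients of U_P count the listings of P whose descent set lies inside T, and
-- inclusion–exclusion recovers |P| and the multiset of descent words from U_P.
--
-- Call a step of a listing a rise if it goes up in the order, i.e. if it is a
-- D_P-descent. In a disjoint union of chains a rise stays inside a chain, so every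
-- listing has at least (#chains − 1) non-rises, with equality exactly when each
-- non-rise enters a new chain (a tight listing); in a tight listing x ≤ y iff x
-- comes before y with only rises in between. Listing P chain after chain is tight.
-- Some listing σ of Q has the same descent word; as each poset realises the tight
-- word of the other, their minimal numbers of non-rises agree, so σ is tight too,
-- and matching the two listings position by position is an isomorphism.
module Submission where

open import Data.Bool using (Bool; true; false; _∧_; _∨_; not; if_then_else_)
import Data.Bool as Bool
open import Data.Bool.ListAction using (any)
import Data.Bool.Properties as Bool
open import Data.Empty using (⊥-elim)
open import Data.Fin as Fin using (Fin; zero; suc; inject₁)
import Data.Fin.Properties as Fin
open import Data.List using (List; []; _∷_; concatMap; concat; map; allFin; filterᵇ; length; _++_; tabulate)
open import Data.List.Membership.DecPropositional using () renaming (_∈?_ to ∈-dec)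
open import Data.List.Membership.Propositional using (_∈_; lose; find)
import Data.List.Membership.Propositional.Properties as ∈
import Data.List.Properties as List
open import Data.List.Relation.Binary.Permutation.Propositional using (↭-sym; ↭⇒↭ₛ)
open import Data.List.Relation.Binary.Permutation.Propositional.Properties using (↭-length)
open import Data.List.Relation.Unary.All as All using (All)
open import Data.List.Relation.Unary.AllPairs using ([]; _∷_)
open import Data.List.Relation.Unary.Any using (here; there)
open import Data.List.Relation.Unary.Any.Properties using (any⁺; any⁻)
open import Data.List.Relation.Unary.Linked as Linked using (Linked; []; [-]; _∷_)
open import Data.List.Relation.Unary.Linked.Properties using (Linked⇒All) renaming (map⁺ to Linked-map⁺)
open import Data.List.Relation.Unary.Unique.Propositional using (Unique)
open import Data.List.Relation.Unary.Unique.Propositional.Properties using (allFin⁺)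
open import Data.Nat as ℕ using (ℕ; zero; suc; _+_; _*_; _≤_; _<_; z≤n; s≤s; _≡ᵇ_)
open import Data.Nat.ListAction using (sum)
import Data.Nat.Properties as ℕ
open import Algebra.Properties.CommutativeSemigroup ℕ.+-commutativeSemigroup using (x∙yz≈y∙xz)
open import Data.Product using (Σ; _×_; _,_; proj₁; proj₂)
open import Data.Sum using (_⊎_; inj₁; inj₂)
import Data.Vec as Vec
import Data.Vec.Properties as Vec
open import Function using (_∘_)
open import Function.Bundles using (_↔_; Equivalence; mk↔ₛ′; mk⇔)
open import Level using (0ℓ)
open import Relation.Binary using (DecidableEquality; Decidable; IsPartialOrder; IsDecTotalOrder; DecTotalOrder; tri<; tri≈; tri>)
import Relation.Binary.PropositionalEquality as PropEq
open import Relation.Binary.PropositionalEquality using (_≡_; _≢_; refl; sym; trans; cong; cong₂; subst; subst₂; module ≡-Reasoning)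
open import Relation.Nullary using (¬_; ⌊_⌋; Dec; yes; no; contradiction)
open import Relation.Nullary.Decidable using (fromWitness; toWitness; _⊎-dec_; _×-dec_)

open import Defs

private
  variable
    A B C : Set

∧-true⁻ : ∀ {a b} → a ∧ b ≡ true → a ≡ true × b ≡ true
∧-true⁻ {true} {true} _ = refl , refl

⌊⌋-true : (d : Dec B) → B → ⌊ d ⌋ ≡ true
⌊⌋-true (yes _) _ = refl
⌊⌋-true (no ¬b) b = ⊥-elim (¬b b)

⌊⌋-false : (d : Dec B) → ¬ B → ⌊ d ⌋ ≡ false
⌊⌋-false (yes b) ¬b = ⊥-elim (¬b b)
⌊⌋-false (no _)  _  = refl

⌊⌋-true⁻ : (d : Dec B) → ⌊ d ⌋ ≡ true → B
⌊⌋-true⁻ (yes b) _ = b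

⌊⌋-cong : (d : Dec B) (e : Dec C) → (B → C) → (C → B) → ⌊ d ⌋ ≡ ⌊ e ⌋
⌊⌋-cong (yes b) e b→c _   = sym (⌊⌋-true e (b→c b))
⌊⌋-cong (no ¬b) e _   c→b = sym (⌊⌋-false e (¬b ∘ c→b))

⌊⌋-∷ : (_≟_ : DecidableEquality A) (x y : A) (xs ys : List A) →
       ⌊ List.≡-dec _≟_ (x ∷ xs) (y ∷ ys) ⌋ ≡ ⌊ x ≟ y ⌋ ∧ ⌊ List.≡-dec _≟_ xs ys ⌋
⌊⌋-∷ _≟_ x y xs ys with x ≟ y | List.≡-dec _≟_ xs ys
... | yes _ | yes _ = refl
... | yes _ | no _  = refl
... | no _  | _     = refl

𝟙 : Bool → ℕ
𝟙 true  = 1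
𝟙 false = 0

count : (A → Bool) → List A → ℕ
count p xs = length (filterᵇ p xs)

count-∷ : ∀ (p : A → Bool) x xs → count p (x ∷ xs) ≡ 𝟙 (p x) + count p xs
count-∷ p x xs with p x
... | true  = refl
... | false = refl

count-cong : ∀ {p q : A → Bool} xs → (∀ x → x ∈ xs → p x ≡ q x) → count p xs ≡ count q xs
count-cong [] _ = refl
count-cong {p = p} {q} (x ∷ xs) p≗q = begin
  count p (x ∷ xs)      ≡⟨ count-∷ p x xs ⟩
  𝟙 (p x) + count p xs  ≡⟨ cong₂ _+_ (cong 𝟙 (p≗q x (here refl))) (count-cong xs (λ y y∈ → p≗q y (there y∈))) ⟩
  𝟙 (q x) + count q xs  ≡⟨ count-∷ q x xs ⟨
  count q (x ∷ xs)      ∎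
  where open ≡-Reasoning

count-none : ∀ {p : A → Bool} xs → (∀ x → x ∈ xs → p x ≡ false) → count p xs ≡ 0
count-none [] _ = refl
count-none {p = p} (x ∷ xs) none = trans (count-∷ p x xs)
  (cong₂ _+_ (cong 𝟙 (none x (here refl))) (count-none xs (λ y y∈ → none y (there y∈))))

count-map : ∀ (p : B → Bool) (f : A → B) xs → count p (map f xs) ≡ count (p ∘ f) xs
count-map p f [] = refl
count-map p f (x ∷ xs) = trans (count-∷ p (f x) (map f xs))
  (trans (cong (𝟙 (p (f x)) +_) (count-map p f xs)) (sym (count-∷ (p ∘ f) x xs)))

count-++ : ∀ (p : A → Bool) xs ys → count p (xs ++ ys) ≡ count p xs + count p ys
count-++ p [] ys = refl
count-++ p (x ∷ xs) ys = begin
  count p (x ∷ xs ++ ys)                ≡⟨ count-∷ p x (xs ++ ys) ⟩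
  𝟙 (p x) + count p (xs ++ ys)          ≡⟨ cong (𝟙 (p x) +_) (count-++ p xs ys) ⟩
  𝟙 (p x) + (count p xs + count p ys)   ≡⟨ ℕ.+-assoc (𝟙 (p x)) _ _ ⟨
  𝟙 (p x) + count p xs + count p ys     ≡⟨ cong (_+ count p ys) (count-∷ p x xs) ⟨
  count p (x ∷ xs) + count p ys         ∎
  where open ≡-Reasoning

count-concatMap : ∀ (p : B → Bool) (f : A → List B) xs →
                  count p (concatMap f xs) ≡ sum (map (count p ∘ f) xs)
count-concatMap p f [] = refl
count-concatMap p f (x ∷ xs) =
  trans (count-++ p (f x) (concat (map f xs))) (cong (count p (f x) +_) (count-concatMap p f xs))

sum-𝟙* : ∀ (q : A → Bool) c xs → sum (map (λ x → 𝟙 (q x) * c) xs) ≡ count q xs * c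
sum-𝟙* q c [] = refl
sum-𝟙* q c (x ∷ xs) = begin
  𝟙 (q x) * c + sum (map (λ x → 𝟙 (q x) * c) xs)  ≡⟨ cong (𝟙 (q x) * c +_) (sum-𝟙* q c xs) ⟩
  𝟙 (q x) * c + count q xs * c                   ≡⟨ ℕ.*-distribʳ-+ c (𝟙 (q x)) (count q xs) ⟨
  (𝟙 (q x) + count q xs) * c                     ≡⟨ cong (_* c) (count-∷ q x xs) ⟨
  count q (x ∷ xs) * c                           ∎
  where open ≡-Reasoning

count-∧ʳ : ∀ (q : A → Bool) b xs → count (λ x → q x ∧ b) xs ≡ count q xs * 𝟙 b
count-∧ʳ q true  xs = trans (count-cong xs (λ x _ → Bool.∧-identityʳ (q x))) (sym (ℕ.*-identityʳ _))
count-∧ʳ q false xs = trans (count-none xs (λ x _ → Bool.∧-zeroʳ (q x))) (sym (ℕ.*-zeroʳ (count q xs)))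

∈⇒0<count : ∀ {p : A → Bool} {x} xs → x ∈ xs → p x ≡ true → 0 < count p xs
∈⇒0<count {p = p} (y ∷ xs) (here refl) px rewrite count-∷ p y xs | px = s≤s z≤n
∈⇒0<count {p = p} (y ∷ xs) (there x∈) px rewrite count-∷ p y xs =
  ℕ.≤-trans (∈⇒0<count xs x∈ px) (ℕ.m≤n+m _ (𝟙 (p y)))

0<count⇒∈ : ∀ {p : A → Bool} xs → 0 < count p xs → Σ A λ x → x ∈ xs × p x ≡ true
0<count⇒∈ {p = p} (y ∷ xs) pos rewrite count-∷ p y xs with p y in py
... | true  = y , here refl , py
... | false with x , x∈ , px ← 0<count⇒∈ xs pos = x , there x∈ , px

any< : ℕ → (ℕ → Bool) → Bool
any< zero    f = false
any< (suc j) f = f j ∨ any< j f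

any<-true⁻ : ∀ j f → any< j f ≡ true → Σ ℕ λ i → i < j × f i ≡ true
any<-true⁻ (suc j) f any≡ with f j in fj
... | true = j , ℕ.≤-refl , fj
... | false with i , i<j , fi ← any<-true⁻ j f any≡ = i , ℕ.m<n⇒m<1+n i<j , fi

any<-true : ∀ j f {i} → i < j → f i ≡ true → any< j f ≡ true
any<-true (suc j) f i<1+j fi with ℕ.m≤n⇒m<n∨m≡n (ℕ.≤-pred i<1+j)
... | inj₂ refl rewrite fi = refl
... | inj₁ i<j  rewrite any<-true j f i<j fi = Bool.∨-zeroʳ (f j)

any<-false : ∀ j f → (∀ i → i < j → f i ≡ false) → any< j f ≡ false
any<-false zero    f _    = refl
any<-false (suc j) f none rewrite none j ℕ.≤-refl = any<-false j f (λ i i<j → none i (ℕ.m<n⇒m<1+n i<j))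

sum< : ℕ → (ℕ → ℕ) → ℕ
sum< zero    f = 0
sum< (suc j) f = f j + sum< j f

sum<-suc : ∀ j f → sum< (suc j) f ≡ f 0 + sum< j (f ∘ suc)
sum<-suc zero    f = refl
sum<-suc (suc j) f = begin
  f (suc j) + sum< (suc j) f              ≡⟨ cong (f (suc j) +_) (sum<-suc j f) ⟩
  f (suc j) + (f 0 + sum< j (f ∘ suc))    ≡⟨ ℕ.+-assoc (f (suc j)) (f 0) _ ⟨
  f (suc j) + f 0 + sum< j (f ∘ suc)      ≡⟨ cong (_+ sum< j (f ∘ suc)) (ℕ.+-comm (f (suc j)) (f 0)) ⟩
  f 0 + f (suc j) + sum< j (f ∘ suc)      ≡⟨ ℕ.+-assoc (f 0) (f (suc j)) _ ⟩
  f 0 + sum< (suc j) (f ∘ suc)            ∎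
  where open ≡-Reasoning

sum<-cong : ∀ j f g → (∀ k → k < j → f k ≡ g k) → sum< j f ≡ sum< j g
sum<-cong zero    f g _   = refl
sum<-cong (suc j) f g f≗g = cong₂ _+_ (f≗g j ℕ.≤-refl) (sum<-cong j f g (λ k k<j → f≗g k (ℕ.m<n⇒m<1+n k<j)))

sum<-mono : ∀ j f g → (∀ k → k < j → f k ≤ g k) → sum< j f ≤ sum< j g
sum<-mono zero    f g _   = z≤n
sum<-mono (suc j) f g f≤g = ℕ.+-mono-≤ (f≤g j ℕ.≤-refl) (sum<-mono j f g (λ k k<j → f≤g k (ℕ.m<n⇒m<1+n k<j)))

sum<-tight : ∀ j f g → (∀ k → k < j → f k ≤ g k) → sum< j f ≡ sum< j g → ∀ k → k < j → f k ≡ g k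
sum<-tight (suc j) f g f≤g sums≡ k k<1+j with ℕ.m≤n⇒m<n∨m≡n (ℕ.≤-pred k<1+j)
... | inj₁ k<j  = sum<-tight j f g f≤g′ rest≡ k k<j
  where
  f≤g′ : ∀ k → k < j → f k ≤ g k
  f≤g′ k k<j = f≤g k (ℕ.m<n⇒m<1+n k<j)
  rest≡ : sum< j f ≡ sum< j g
  rest≡ = ℕ.≤-antisym (sum<-mono j f g f≤g′)
    (ℕ.+-cancelˡ-≤ (g j) _ _ (ℕ.≤-trans (ℕ.≤-reflexive (sym sums≡)) (ℕ.+-monoˡ-≤ (sum< j f) (f≤g j ℕ.≤-refl))))
... | inj₂ refl = ℕ.≤-antisym (f≤g j ℕ.≤-refl)
    (ℕ.+-cancelʳ-≤ (sum< j f) _ _ (ℕ.≤-trans (ℕ.+-monoʳ-≤ (g j) (sum<-mono j f g (λ k k<j → f≤g k (ℕ.m<n⇒m<1+n k<j))))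
                                          (ℕ.≤-reflexive (sym sums≡))))

nth : List A → A → ℕ → A
nth []       d _       = d
nth (x ∷ xs) d zero    = x
nth (x ∷ xs) d (suc i) = nth xs d i

nth-∈ : ∀ (xs : List A) d {i} → i < length xs → nth xs d i ∈ xs
nth-∈ (x ∷ xs) d {zero}  _         = here refl
nth-∈ (x ∷ xs) d {suc i} (s≤s i<) = there (nth-∈ xs d i<)

∈⇒nth : ∀ {x} (xs : List A) d → x ∈ xs → Σ ℕ λ i → i < length xs × nth xs d i ≡ x
∈⇒nth (y ∷ xs) d (here refl) = zero , s≤s z≤n , refl
∈⇒nth (y ∷ xs) d (there x∈) with i , i< , xᵢ ← ∈⇒nth xs d x∈ = suc i , s≤s i< , xᵢ

nth-injective : ∀ (xs : List A) d → Unique xs → ∀ {i j} → i < length xs → j < length xs →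
                nth xs d i ≡ nth xs d j → i ≡ j
nth-injective (x ∷ xs) d _          {zero}  {zero}  _        _        _ = refl
nth-injective (x ∷ xs) d (x∉ ∷ _)   {zero}  {suc j} _        (s≤s j<) e = ⊥-elim (All.lookup x∉ (nth-∈ xs d j<) e)
nth-injective (x ∷ xs) d (x∉ ∷ _)   {suc i} {zero}  (s≤s i<) _        e = ⊥-elim (All.lookup x∉ (nth-∈ xs d i<) (sym e))
nth-injective (x ∷ xs) d (_ ∷ uniq) {suc i} {suc j} (s≤s i<) (s≤s j<) e = cong suc (nth-injective xs d uniq i< j< e)

Unique-⊆⇒length-≤ : ∀ {xs ys : List A} → Unique xs → (∀ {z} → z ∈ xs → z ∈ ys) → length xs ≤ length ys
Unique-⊆⇒length-≤ {xs = []} _ _ = z≤n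
Unique-⊆⇒length-≤ {xs = x ∷ xs} {ys} (x∉ ∷ uniq) ⊆ys with ys₁ , ys₂ , refl ← ∈.∈-∃++ (⊆ys (here refl)) = begin
  suc (length xs)               ≤⟨ s≤s (Unique-⊆⇒length-≤ uniq ⊆ys₁++ys₂) ⟩
  suc (length (ys₁ ++ ys₂))     ≡⟨ cong suc (List.length-++ ys₁) ⟩
  suc (length ys₁ + length ys₂) ≡⟨ ℕ.+-suc (length ys₁) (length ys₂) ⟨
  length ys₁ + suc (length ys₂) ≡⟨ List.length-++ ys₁ ⟨
  length (ys₁ ++ x ∷ ys₂)       ∎
  where
  open ℕ.≤-Reasoning
  ⊆ys₁++ys₂ : ∀ {z} → z ∈ xs → z ∈ ys₁ ++ ys₂
  ⊆ys₁++ys₂ z∈ with ∈.∈-++⁻ ys₁ (⊆ys (there z∈))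
  ... | inj₁ z∈ys₁          = ∈.∈-++⁺ˡ z∈ys₁
  ... | inj₂ (here refl)    = ⊥-elim (All.lookup x∉ z∈ refl)
  ... | inj₂ (there z∈ys₂)  = ∈.∈-++⁺ʳ ys₁ z∈ys₂

Unique-complete : ∀ {n} (τ : List (Fin n)) → Unique τ → length τ ≡ n → ∀ x → x ∈ τ
Unique-complete {n} τ uniq |τ|≡n x with ∈-dec Fin._≟_ x τ
... | yes x∈ = x∈
... | no  x∉ = ⊥-elim (ℕ.<-irrefl |τ|≡n (begin-strict
  length τ          <⟨ Unique-⊆⇒length-≤ (All.tabulate (λ y∈ x≡y → x∉ (subst (_∈ τ) (sym x≡y) y∈)) ∷ uniq) (λ {z} _ → ∈.∈-allFin z) ⟩
  length (allFin n) ≡⟨ List.length-tabulate _ ⟩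
  n                 ∎))
  where open ℕ.≤-Reasoning

occurrences : ∀ {m} → Fin m → List (Fin m) → ℕ
occurrences k = count (λ x → ⌊ k Fin.≟ x ⌋)

occurrences-head : ∀ {m} (a : Fin m) s → occurrences a (a ∷ s) ≡ suc (occurrences a s)
occurrences-head a s rewrite count-∷ (λ x → ⌊ a Fin.≟ x ⌋) a s | ⌊⌋-true (a Fin.≟ a) refl = refl

occurrences-above : ∀ {m} {a : Fin m} {s} → All (a Fin.<_) s → occurrences a s ≡ 0
occurrences-above {a = a} {s} a<s =
  count-none s (λ x x∈ → ⌊⌋-false (a Fin.≟ x) (λ { refl → ℕ.<-irrefl refl (All.lookup a<s x∈) }))

head<⇒occurrences≡0 : ∀ {m} {a b : Fin m} {t} → a Fin.< b → Linked Fin._≤_ (b ∷ t) → occurrences a (b ∷ t) ≡ 0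
head<⇒occurrences≡0 a<b sorted =
  occurrences-above (All.map (ℕ.<-≤-trans a<b) (Linked⇒All Fin.≤-trans Fin.≤-refl sorted))

sorted-occurrences-injective : ∀ {m} (s t : List (Fin m)) → Linked Fin._≤_ s → Linked Fin._≤_ t →
                               (∀ k → occurrences k s ≡ occurrences k t) → s ≡ t
sorted-occurrences-injective []      []      _ _ _    = refl
sorted-occurrences-injective []      (b ∷ t) _ _ occ≡ = ⊥-elim (ℕ.0≢1+n (trans (occ≡ b) (occurrences-head b t)))
sorted-occurrences-injective (a ∷ s) []      _ _ occ≡ = ⊥-elim (ℕ.1+n≢0 (trans (sym (occurrences-head a s)) (occ≡ a)))
sorted-occurrences-injective (a ∷ s) (b ∷ t) ↗s ↗t occ≡ with Fin.<-cmp a b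
... | tri< a<b _ _ = ⊥-elim (ℕ.1+n≢0 (trans (sym (occurrences-head a s)) (trans (occ≡ a) (head<⇒occurrences≡0 a<b ↗t))))
... | tri> _ _ b<a = ⊥-elim (ℕ.1+n≢0 (trans (sym (occurrences-head b t)) (trans (sym (occ≡ b)) (head<⇒occurrences≡0 b<a ↗s))))
... | tri≈ _ refl _ = cong (a ∷_) (sorted-occurrences-injective s t (Linked.tail ↗s) (Linked.tail ↗t) λ k →
  ℕ.+-cancelˡ-≡ (𝟙 ⌊ k Fin.≟ a ⌋) _ _ (trans (sym (count-∷ _ a s)) (trans (occ≡ k) (count-∷ _ a t))))

content-occurrences : ∀ {m} (s : List (Fin m)) k → Vec.lookup (content s) k ≡ occurrences k s
content-occurrences s k = Vec.lookup∘tabulate _ k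

sorted-content-injective : ∀ {m} {s t : List (Fin m)} → Linked Fin._≤_ s → Linked Fin._≤_ t →
                           content s ≡ content t → s ≡ t
sorted-content-injective {s = s} {t} ↗s ↗t content≡ = sorted-occurrences-injective s t ↗s ↗t λ k →
  trans (sym (content-occurrences s k)) (trans (cong (λ v → Vec.lookup v k) content≡) (content-occurrences t k))

admissibleStep : ∀ {m} → Bool → Fin m → Fin m → Bool
admissibleStep c a b = if c then ⌊ a Fin.<? b ⌋ else ⌊ a Fin.≤? b ⌋

admissible⇒sorted : ∀ {m} I j (s : List (Fin m)) → admissible I j s ≡ true → Linked Fin._≤_ s
admissible⇒sorted I j []          _   = []
admissible⇒sorted I j (a ∷ [])    _   = [-]
admissible⇒sorted I j (a ∷ b ∷ r) adm =
  a≤b (I j) (proj₁ step,rest) ∷ admissible⇒sorted I (suc j) (b ∷ r) (proj₂ step,rest)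
  where
  step,rest : admissibleStep (I j) a b ≡ true × admissible I (suc j) (b ∷ r) ≡ true
  step,rest = ∧-true⁻ adm
  a≤b : ∀ c → admissibleStep c a b ≡ true → a Fin.≤ b
  a≤b true  a<b = ℕ.<⇒≤ (⌊⌋-true⁻ (a Fin.<? b) a<b)
  a≤b false a≤b = ⌊⌋-true⁻ (a Fin.≤? b) a≤b

_≟ₗ_ : ∀ {m} → DecidableEquality (List (Fin m))
_≟ₗ_ = List.≡-dec Fin._≟_

count-≟-unique : ∀ (_≟_ : DecidableEquality A) {a xs} → Unique xs → a ∈ xs → count (λ x → ⌊ x ≟ a ⌋) xs ≡ 1
count-≟-unique _≟_ {a} {a ∷ xs} (a∉ ∷ _) (here refl) = trans (count-∷ _ a xs)
  (cong₂ _+_ (cong 𝟙 (⌊⌋-true (a ≟ a) refl)) (count-none xs (λ y y∈ → ⌊⌋-false (y ≟ a) (All.lookup a∉ y∈ ∘ sym))))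
count-≟-unique _≟_ {a} {x ∷ xs} (x∉ ∷ uniq) (there a∈) = trans (count-∷ _ x xs)
  (cong₂ _+_ (cong 𝟙 (⌊⌋-false (x ≟ a) (All.lookup x∉ a∈))) (count-≟-unique _≟_ uniq a∈))

count-allSeqs : ∀ n m (t : List (Fin m)) → count (λ s → ⌊ s ≟ₗ t ⌋) (allSeqs n m) ≡ 𝟙 (length t ≡ᵇ n)
count-allSeqs zero    m []      = refl
count-allSeqs zero    m (a ∷ t) = refl
count-allSeqs (suc n) m t = trans (count-concatMap _ (λ s → map (_∷ s) (allFin m)) (allSeqs n m)) (extend t)
  where
  open ≡-Reasoning
  extensions : ∀ t → List (Fin m) → ℕ
  extensions t s = count (λ s′ → ⌊ s′ ≟ₗ t ⌋) (map (_∷ s) (allFin m))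
  no-extension : ∀ s → extensions [] s ≡ 0
  no-extension s = trans (count-map _ (_∷ s) (allFin m)) (count-none (allFin m) (λ _ _ → refl))
  extend : ∀ t → sum (map (extensions t) (allSeqs n m)) ≡ 𝟙 (length t ≡ᵇ suc n)
  extend [] = trans (cong sum (List.map-cong no-extension (allSeqs n m)))
                    (trans (sum-𝟙* (λ _ → false) 0 (allSeqs n m)) (ℕ.*-zeroʳ (count (λ _ → false) (allSeqs n m))))
  extend (a ∷ t) = begin
    sum (map (extensions (a ∷ t)) (allSeqs n m))            ≡⟨ cong sum (List.map-cong one-extension (allSeqs n m)) ⟩
    sum (map (λ s → 𝟙 ⌊ s ≟ₗ t ⌋ * 1) (allSeqs n m))        ≡⟨ sum-𝟙* (λ s → ⌊ s ≟ₗ t ⌋) 1 (allSeqs n m) ⟩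
    count (λ s → ⌊ s ≟ₗ t ⌋) (allSeqs n m) * 1              ≡⟨ ℕ.*-identityʳ _ ⟩
    count (λ s → ⌊ s ≟ₗ t ⌋) (allSeqs n m)                  ≡⟨ count-allSeqs n m t ⟩
    𝟙 (length t ≡ᵇ n)                                    ∎
    where
    one-extension : ∀ s → extensions (a ∷ t) s ≡ 𝟙 ⌊ s ≟ₗ t ⌋ * 1
    one-extension s = begin
      count (λ s′ → ⌊ s′ ≟ₗ (a ∷ t) ⌋) (map (_∷ s) (allFin m))  ≡⟨ count-map _ (_∷ s) (allFin m) ⟩
      count (λ x → ⌊ (x ∷ s) ≟ₗ (a ∷ t) ⌋) (allFin m)          ≡⟨ count-cong (allFin m) (λ x _ → ⌊⌋-∷ Fin._≟_ x a s t) ⟩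
      count (λ x → ⌊ x Fin.≟ a ⌋ ∧ ⌊ s ≟ₗ t ⌋) (allFin m)      ≡⟨ count-∧ʳ _ ⌊ s ≟ₗ t ⌋ (allFin m) ⟩
      count (λ x → ⌊ x Fin.≟ a ⌋) (allFin m) * 𝟙 ⌊ s ≟ₗ t ⌋   ≡⟨ cong (_* 𝟙 ⌊ s ≟ₗ t ⌋) (count-≟-unique Fin._≟_ (allFin⁺ m) (∈.∈-allFin a)) ⟩
      1 * 𝟙 ⌊ s ≟ₗ t ⌋                                        ≡⟨ ℕ.*-comm 1 _ ⟩
      𝟙 ⌊ s ≟ₗ t ⌋ * 1                                        ∎

0<𝟙⁻ : ∀ {b} → 0 < 𝟙 b → b ≡ true
0<𝟙⁻ {true} _ = refl

≡ᵇ-true⁻ : ∀ {m n} → (m ≡ᵇ n) ≡ true → m ≡ n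
≡ᵇ-true⁻ {m} {n} eq = ℕ.≡ᵇ⇒≡ m n (Equivalence.from Bool.T-≡ eq)

≡ᵇ-refl : ∀ n → (n ≡ᵇ n) ≡ true
≡ᵇ-refl zero    = refl
≡ᵇ-refl (suc n) = ≡ᵇ-refl n

∈allSeqs⇒length : ∀ {n m} {s : List (Fin m)} → s ∈ allSeqs n m → length s ≡ n
∈allSeqs⇒length {n} {m} {s} s∈ = ≡ᵇ-true⁻ (0<𝟙⁻ (subst (0 <_) (count-allSeqs n m s)
  (∈⇒0<count (allSeqs n m) s∈ (⌊⌋-true (s ≟ₗ s) refl))))

length⇒∈allSeqs : ∀ {n m} (s : List (Fin m)) → length s ≡ n → s ∈ allSeqs n m
length⇒∈allSeqs {m = m} s refl
  with t , t∈ , t≟s ← 0<count⇒∈ (allSeqs (length s) m)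
         (subst (0 <_) (sym (trans (count-allSeqs (length s) m s) (cong 𝟙 (≡ᵇ-refl (length s))))) (s≤s z≤n))
  = subst (_∈ allSeqs (length s) m) (⌊⌋-true⁻ (t ≟ₗ s) t≟s) t∈

distinct⇒Unique : ∀ {m} (s : List (Fin m)) → distinct s ≡ true → Unique s
distinct⇒Unique []       _ = []
distinct⇒Unique (x ∷ xs) d with any (λ y → ⌊ x Fin.≟ y ⌋) xs in any≡ | d
... | false | d′ = All.tabulate x∉xs ∷ distinct⇒Unique xs d′
  where
  x∉xs : ∀ {y} → y ∈ xs → x ≢ y
  x∉xs y∈ x≡y = subst Bool.T any≡ (any⁺ _ (lose y∈ (fromWitness x≡y)))

Unique⇒distinct : ∀ {m} (s : List (Fin m)) → Unique s → distinct s ≡ true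
Unique⇒distinct []       _            = refl
Unique⇒distinct (x ∷ xs) (x∉xs ∷ uniq) with any (λ y → ⌊ x Fin.≟ y ⌋) xs in any≡
... | false = Unique⇒distinct xs uniq
... | true  with y∈ ← any⁻ _ xs (Equivalence.from Bool.T-≡ any≡) with y , y∈xs , x≟y ← find y∈ =
  ⊥-elim (All.lookup x∉xs y∈xs (toWitness x≟y))

∈listings⁻ : ∀ {n} {τ : List (Fin n)} → τ ∈ listings n → Unique τ × length τ ≡ n
∈listings⁻ {n} {τ} τ∈ with τ∈allSeqs , d ← ∈.∈-filter⁻ (Bool.T? ∘ distinct) {xs = allSeqs n n} τ∈ =
  distinct⇒Unique τ (Equivalence.to Bool.T-≡ d) , ∈allSeqs⇒length τ∈allSeqs

∈listings⁺ : ∀ {n} {τ : List (Fin n)} → Unique τ → length τ ≡ n → τ ∈ listings n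
∈listings⁺ {n} {τ} uniq |τ|≡n =
  ∈.∈-filter⁺ (Bool.T? ∘ distinct) (length⇒∈allSeqs τ |τ|≡n) (Equivalence.from Bool.T-≡ (Unique⇒distinct τ uniq))

lift : Bool → ∀ {k} → Fin k → Fin (suc k)
lift true  = suc
lift false = inject₁

staircase : (T : List Bool) → List (Fin (suc (length T)))
staircase []      = zero ∷ []
staircase (b ∷ T) = zero ∷ map (lift b) (staircase T)

staircase-length : ∀ T → length (staircase T) ≡ suc (length T)
staircase-length []      = refl
staircase-length (b ∷ T) = cong suc (trans (List.length-map (lift b) (staircase T)) (staircase-length T))

lift-⌊≤?⌋ : ∀ b {k} (x y : Fin k) → ⌊ lift b x Fin.≤? lift b y ⌋ ≡ ⌊ x Fin.≤? y ⌋
lift-⌊≤?⌋ true  x y = ⌊⌋-cong (suc x Fin.≤? suc y) (x Fin.≤? y) ℕ.≤-pred s≤s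
lift-⌊≤?⌋ false x y = ⌊⌋-cong (inject₁ x Fin.≤? inject₁ y) (x Fin.≤? y)
  (subst₂ _≤_ (Fin.toℕ-inject₁ x) (Fin.toℕ-inject₁ y)) (subst₂ _≤_ (sym (Fin.toℕ-inject₁ x)) (sym (Fin.toℕ-inject₁ y)))

lift-⌊<?⌋ : ∀ b {k} (x y : Fin k) → ⌊ lift b x Fin.<? lift b y ⌋ ≡ ⌊ x Fin.<? y ⌋
lift-⌊<?⌋ true  x y = ⌊⌋-cong (suc x Fin.<? suc y) (x Fin.<? y) ℕ.≤-pred s≤s
lift-⌊<?⌋ false x y = ⌊⌋-cong (inject₁ x Fin.<? inject₁ y) (x Fin.<? y)
  (subst₂ _<_ (Fin.toℕ-inject₁ x) (Fin.toℕ-inject₁ y)) (subst₂ _<_ (sym (Fin.toℕ-inject₁ x)) (sym (Fin.toℕ-inject₁ y)))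

lift-mono : ∀ b {k} {x y : Fin k} → x Fin.≤ y → lift b x Fin.≤ lift b y
lift-mono b {x = x} {y} x≤y = ⌊⌋-true⁻ (lift b x Fin.≤? lift b y) (trans (lift-⌊≤?⌋ b x y) (⌊⌋-true (x Fin.≤? y) x≤y))

zero∷-sorted : ∀ {k} {s : List (Fin (suc k))} → Linked Fin._≤_ s → Linked Fin._≤_ (zero ∷ s)
zero∷-sorted {s = []}    _      = [-]
zero∷-sorted {s = _ ∷ _} sorted = z≤n ∷ sorted

staircase-sorted : ∀ T → Linked Fin._≤_ (staircase T)
staircase-sorted []      = [-]
staircase-sorted (b ∷ T) = zero∷-sorted (Linked-map⁺ (Linked.map (lift-mono b) (staircase-sorted T)))

admissible-map-lift : ∀ b {k} I j (s : List (Fin k)) → admissible I j (map (lift b) s) ≡ admissible I j s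
admissible-map-lift b I j []          = refl
admissible-map-lift b I j (x ∷ [])    = refl
admissible-map-lift b I j (x ∷ y ∷ r) = cong₂ _∧_
  (cong₂ (λ u v → if I j then u else v) (lift-⌊<?⌋ b x y) (lift-⌊≤?⌋ b x y)) (admissible-map-lift b I (suc j) (y ∷ r))

admissible-suc : ∀ {k} I j (s : List (Fin k)) → admissible I (suc j) s ≡ admissible (I ∘ suc) j s
admissible-suc I j []          = refl
admissible-suc I j (x ∷ [])    = refl
admissible-suc I j (x ∷ y ∷ r) = cong (admissibleStep (I (suc j)) x y ∧_) (admissible-suc I (suc j) (y ∷ r))

bits : (ℕ → Bool) → ℕ → List Bool
bits I zero    = []
bits I (suc ℓ) = I 1 ∷ bits (I ∘ suc) ℓ

bits-length : ∀ I ℓ → length (bits I ℓ) ≡ ℓ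
bits-length I zero    = refl
bits-length I (suc ℓ) = cong suc (bits-length (I ∘ suc) ℓ)

bits-injective : ∀ I J ℓ → bits I ℓ ≡ bits J ℓ → ∀ k → k < ℓ → I (suc k) ≡ J (suc k)
bits-injective I J (suc ℓ) eq zero    _        = List.∷-injectiveˡ eq
bits-injective I J (suc ℓ) eq (suc k) (s≤s k<) = bits-injective (I ∘ suc) (J ∘ suc) ℓ (List.∷-injectiveʳ eq) k k<

_⊆ᵇ_ : List Bool → List Bool → Bool
[]       ⊆ᵇ []       = true
(d ∷ ds) ⊆ᵇ (t ∷ ts) = (if d then t else true) ∧ (ds ⊆ᵇ ts)
[]       ⊆ᵇ (_ ∷ _)  = false
(_ ∷ _)  ⊆ᵇ []       = false

⊆ᵇ-refl : ∀ d → d ⊆ᵇ d ≡ true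
⊆ᵇ-refl []          = refl
⊆ᵇ-refl (true ∷ d)  = ⊆ᵇ-refl d
⊆ᵇ-refl (false ∷ d) = ⊆ᵇ-refl d

admissibleStep-zero-lift : ∀ c b {k} → admissibleStep c (zero {suc k}) (lift b zero) ≡ (if c then b else true)
admissibleStep-zero-lift true  true  = refl
admissibleStep-zero-lift true  false = refl
admissibleStep-zero-lift false true  = refl
admissibleStep-zero-lift false false = refl

admissible-climb : ∀ I b {k} (rest : List (Fin (suc k))) →
                   admissible I 1 (zero ∷ map (lift b) (zero ∷ rest)) ≡
                   (if I 1 then b else true) ∧ admissible (I ∘ suc) 1 (zero ∷ rest)
admissible-climb I b rest = cong₂ _∧_ (admissibleStep-zero-lift (I 1) b)
  (trans (admissible-map-lift b I 2 (zero ∷ rest)) (admissible-suc I 1 (zero ∷ rest)))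

admissible-staircase : ∀ I T → admissible I 1 (staircase T) ≡ bits I (length T) ⊆ᵇ T
admissible-staircase I []          = refl
admissible-staircase I (b ∷ [])    = admissible-climb I b []
admissible-staircase I (b ∷ c ∷ T) = trans (admissible-climb I b (map (lift c) (staircase T)))
  (cong ((if I 1 then b else true) ∧_) (admissible-staircase (I ∘ suc) (c ∷ T)))

coeffF-staircase : ∀ n I T → coeffF n I (content (staircase T)) ≡ 𝟙 (suc (length T) ≡ᵇ n) * 𝟙 (bits I (length T) ⊆ᵇ T)
coeffF-staircase n I T = begin
  coeffF n I (content t)                                        ≡⟨ count-cong (allSeqs n _) (λ s _ → only-t s) ⟩
  count (λ s → ⌊ s ≟ₗ t ⌋ ∧ admissible I 1 t) (allSeqs n _)     ≡⟨ count-∧ʳ _ (admissible I 1 t) (allSeqs n _) ⟩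
  count (λ s → ⌊ s ≟ₗ t ⌋) (allSeqs n _) * 𝟙 (admissible I 1 t) ≡⟨ cong₂ _*_ (count-allSeqs n _ t) (cong 𝟙 (admissible-staircase I T)) ⟩
  𝟙 (length t ≡ᵇ n) * 𝟙 (bits I (length T) ⊆ᵇ T)               ≡⟨ cong (λ l → 𝟙 (l ≡ᵇ n) * 𝟙 (bits I (length T) ⊆ᵇ T)) (staircase-length T) ⟩
  𝟙 (suc (length T) ≡ᵇ n) * 𝟙 (bits I (length T) ⊆ᵇ T)         ∎
  where
  open ≡-Reasoning
  t : List (Fin (suc (length T)))
  t = staircase T
  only-t : ∀ s → admissible I 1 s ∧ ⌊ Vec.≡-dec ℕ._≟_ (content s) (content t) ⌋ ≡ ⌊ s ≟ₗ t ⌋ ∧ admissible I 1 t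
  only-t s with s ≟ₗ t
  ... | yes refl = trans (cong (admissible I 1 s ∧_) (⌊⌋-true (Vec.≡-dec ℕ._≟_ (content s) (content s)) refl)) (Bool.∧-identityʳ _)
  ... | no s≢t with admissible I 1 s in adm
  ...   | false = refl
  ...   | true  = ⌊⌋-false (Vec.≡-dec ℕ._≟_ (content s) (content t))
                    (s≢t ∘ sorted-content-injective (admissible⇒sorted I 1 s adm) (staircase-sorted T))

descentWords : Digraph → ℕ → List (List Bool)
descentWords X ℓ = map (λ π → bits (XDes (Digraph.edge X) π) ℓ) (listings (Digraph.size X))

coeffU-staircase : ∀ X T → coeffU X (content (staircase T)) ≡
                   count (_⊆ᵇ T) (descentWords X (length T)) * 𝟙 (suc (length T) ≡ᵇ Digraph.size X)
coeffU-staircase X T = begin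
  sum (map (λ π → coeffF n (XDes e π) (content (staircase T))) (listings n))   ≡⟨ cong sum (List.map-cong term (listings n)) ⟩
  sum (map (λ π → 𝟙 (word π ⊆ᵇ T) * 𝟙 (suc (length T) ≡ᵇ n)) (listings n))     ≡⟨ sum-𝟙* (λ π → word π ⊆ᵇ T) _ (listings n) ⟩
  count (λ π → word π ⊆ᵇ T) (listings n) * 𝟙 (suc (length T) ≡ᵇ n)            ≡⟨ cong (_* 𝟙 (suc (length T) ≡ᵇ n)) (count-map (_⊆ᵇ T) word (listings n)) ⟨
  count (_⊆ᵇ T) (descentWords X (length T)) * 𝟙 (suc (length T) ≡ᵇ n)         ∎
  where
  open ≡-Reasoning
  open Digraph X renaming (size to n; edge to e)
  word : List (Fin n) → List Bool
  word π = bits (XDes e π) (length T)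
  term : ∀ π → coeffF n (XDes e π) (content (staircase T)) ≡ 𝟙 (word π ⊆ᵇ T) * 𝟙 (suc (length T) ≡ᵇ n)
  term π = trans (coeffF-staircase n (XDes e π) T) (ℕ.*-comm (𝟙 (suc (length T) ≡ᵇ n)) _)

strip : Bool → List (List Bool) → List (List Bool)
strip b     []                  = []
strip b     ([] ∷ L)            = strip b L
strip false ((false ∷ d) ∷ L)   = d ∷ strip false L
strip false ((true  ∷ _) ∷ L)   = strip false L
strip true  ((false ∷ _) ∷ L)   = strip true L
strip true  ((true  ∷ d) ∷ L)   = d ∷ strip true L

count-by-head : ∀ (q : List Bool → Bool) L → q [] ≡ false →
                count q L ≡ count (q ∘ (false ∷_)) (strip false L) + count (q ∘ (true ∷_)) (strip true L)
count-by-head q []                _    = refl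
count-by-head q ([] ∷ L)          q[]  = trans (count-∷ q [] L) (trans (cong (λ b → 𝟙 b + count q L) q[]) (count-by-head q L q[]))
count-by-head q ((c ∷ d) ∷ L) q[] = begin
  count q ((c ∷ d) ∷ L)                       ≡⟨ count-∷ q (c ∷ d) L ⟩
  𝟙 (q (c ∷ d)) + count q L                   ≡⟨ cong (𝟙 (q (c ∷ d)) +_) (count-by-head q L q[]) ⟩
  𝟙 (q (c ∷ d)) + (count₀ L + count₁ L)       ≡⟨ absorb c ⟩
  count₀ ((c ∷ d) ∷ L) + count₁ ((c ∷ d) ∷ L) ∎
  where
  open ≡-Reasoning
  count₀ count₁ : List (List Bool) → ℕ
  count₀ L = count (q ∘ (false ∷_)) (strip false L)
  count₁ L = count (q ∘ (true ∷_)) (strip true L)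
  absorb : ∀ c → 𝟙 (q (c ∷ d)) + (count₀ L + count₁ L) ≡ count₀ ((c ∷ d) ∷ L) + count₁ ((c ∷ d) ∷ L)
  absorb false = trans (sym (ℕ.+-assoc (𝟙 (q (false ∷ d))) (count₀ L) (count₁ L)))
                       (cong (_+ count₁ L) (sym (count-∷ (q ∘ (false ∷_)) d (strip false L))))
  absorb true  = trans (x∙yz≈y∙xz (𝟙 (q (true ∷ d))) (count₀ L) (count₁ L))
                       (cong (count₀ L +_) (sym (count-∷ (q ∘ (true ∷_)) d (strip true L))))

_≟ᵇₗ_ : DecidableEquality (List Bool)
_≟ᵇₗ_ = List.≡-dec Bool._≟_

count-≟-∷ : ∀ b I L → count (λ d → ⌊ d ≟ᵇₗ (b ∷ I) ⌋) L ≡ count (λ d → ⌊ d ≟ᵇₗ I ⌋) (strip b L)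
count-≟-∷ b I L = trans (count-by-head _ L refl) (heads-sum b)
  where
  heads : Bool → Bool → ℕ
  heads c b = count (λ d → ⌊ (c ∷ d) ≟ᵇₗ (b ∷ I) ⌋) (strip c L)
  mismatch : ∀ c b → c ≢ b → heads c b ≡ 0
  mismatch c b c≢b = count-none (strip c L) (λ d _ → trans (⌊⌋-∷ Bool._≟_ c b d I) (cong (_∧ _) (⌊⌋-false (c Bool.≟ b) c≢b)))
  match : ∀ b → heads b b ≡ count (λ d → ⌊ d ≟ᵇₗ I ⌋) (strip b L)
  match b = count-cong (strip b L) (λ d _ → trans (⌊⌋-∷ Bool._≟_ b b d I) (cong (_∧ _) (⌊⌋-true (b Bool.≟ b) refl)))
  heads-sum : ∀ b → heads false b + heads true b ≡ count (λ d → ⌊ d ≟ᵇₗ I ⌋) (strip b L)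
  heads-sum false = trans (cong₂ _+_ (match false) (mismatch true false (λ ()))) (ℕ.+-identityʳ _)
  heads-sum true  = cong₂ _+_ (mismatch false true (λ ())) (match true)

-- Möbius inversion on the Boolean lattice, one letter at a time: the ⊆-counts for
-- true ∷ B minus those for false ∷ B are the ⊆-counts of the words beginning with true.
counts-⊆⇒counts-≡ : ∀ I (L₁ L₂ : List (List Bool)) →
                    (∀ B → length B ≡ length I → count (_⊆ᵇ B) L₁ ≡ count (_⊆ᵇ B) L₂) →
                    count (λ d → ⌊ d ≟ᵇₗ I ⌋) L₁ ≡ count (λ d → ⌊ d ≟ᵇₗ I ⌋) L₂
counts-⊆⇒counts-≡ [] L₁ L₂ ⊆≡ =
  trans (count-cong L₁ (λ d _ → only[] d)) (trans (⊆≡ [] refl) (sym (count-cong L₂ (λ d _ → only[] d))))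
  where
  only[] : ∀ d → ⌊ d ≟ᵇₗ [] ⌋ ≡ d ⊆ᵇ []
  only[] []      = refl
  only[] (_ ∷ _) = refl
counts-⊆⇒counts-≡ (b ∷ I) L₁ L₂ ⊆≡ = begin
  count (λ d → ⌊ d ≟ᵇₗ (b ∷ I) ⌋) L₁    ≡⟨ count-≟-∷ b I L₁ ⟩
  count (λ d → ⌊ d ≟ᵇₗ I ⌋) (strip b L₁) ≡⟨ counts-⊆⇒counts-≡ I (strip b L₁) (strip b L₂) (stripped b) ⟩
  count (λ d → ⌊ d ≟ᵇₗ I ⌋) (strip b L₂) ≡⟨ count-≟-∷ b I L₂ ⟨
  count (λ d → ⌊ d ≟ᵇₗ (b ∷ I) ⌋) L₂    ∎
  where
  open ≡-Reasoning
  ⊆false∷ : ∀ B L → count (_⊆ᵇ (false ∷ B)) L ≡ count (_⊆ᵇ B) (strip false L)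
  ⊆false∷ B L = trans (count-by-head _ L refl)
    (trans (cong (count (_⊆ᵇ B) (strip false L) +_) (count-none (strip true L) (λ _ _ → refl))) (ℕ.+-identityʳ _))
  ⊆true∷ : ∀ B L → count (_⊆ᵇ (true ∷ B)) L ≡ count (_⊆ᵇ B) (strip false L) + count (_⊆ᵇ B) (strip true L)
  ⊆true∷ B L = count-by-head _ L refl
  stripped : ∀ b B → length B ≡ length I → count (_⊆ᵇ B) (strip b L₁) ≡ count (_⊆ᵇ B) (strip b L₂)
  stripped false B |B| = trans (sym (⊆false∷ B L₁)) (trans (⊆≡ (false ∷ B) (cong suc |B|)) (⊆false∷ B L₂))
  stripped true  B |B| = ℕ.+-cancelˡ-≡ (count (_⊆ᵇ B) (strip false L₁)) _ _ (begin
    count (_⊆ᵇ B) (strip false L₁) + count (_⊆ᵇ B) (strip true L₁) ≡⟨ ⊆true∷ B L₁ ⟨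
    count (_⊆ᵇ (true ∷ B)) L₁                                       ≡⟨ ⊆≡ (true ∷ B) (cong suc |B|) ⟩
    count (_⊆ᵇ (true ∷ B)) L₂                                       ≡⟨ ⊆true∷ B L₂ ⟩
    count (_⊆ᵇ B) (strip false L₂) + count (_⊆ᵇ B) (strip true L₂) ≡⟨ cong (_+ count (_⊆ᵇ B) (strip true L₂)) (stripped false B |B|) ⟨
    count (_⊆ᵇ B) (strip false L₁) + count (_⊆ᵇ B) (strip true L₂) ∎)

coeffU-staircase-count : ∀ X T → Digraph.size X ≡ suc (length T) →
                         coeffU X (content (staircase T)) ≡ count (_⊆ᵇ T) (descentWords X (length T))
coeffU-staircase-count X T size≡ = begin
  coeffU X (content (staircase T))                   ≡⟨ coeffU-staircase X T ⟩
  c * 𝟙 (suc (length T) ≡ᵇ Digraph.size X)           ≡⟨ cong (λ n → c * 𝟙 (suc (length T) ≡ᵇ n)) size≡ ⟩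
  c * 𝟙 (suc (length T) ≡ᵇ suc (length T))           ≡⟨ cong (λ b → c * 𝟙 b) (≡ᵇ-refl (length T)) ⟩
  c * 1                                              ≡⟨ ℕ.*-identityʳ c ⟩
  c                                                  ∎
  where
  open ≡-Reasoning
  c : ℕ
  c = count (_⊆ᵇ T) (descentWords X (length T))

coeffU-staircase-positive⁻ : ∀ X T → 0 < coeffU X (content (staircase T)) → Digraph.size X ≡ suc (length T)
coeffU-staircase-positive⁻ X T pos =
  sym (≡ᵇ-true⁻ (0<*𝟙⁻ {a = count (_⊆ᵇ T) (descentWords X (length T))} (subst (0 <_) (coeffU-staircase X T) pos)))
  where
  0<*𝟙⁻ : ∀ {a b} → 0 < a * 𝟙 b → b ≡ true
  0<*𝟙⁻ {a} {false} pos = ⊥-elim (ℕ.<-irrefl (sym (ℕ.*-zeroʳ a)) pos)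
  0<*𝟙⁻ {a} {true}  _   = refl

allFin∈listings : ∀ n → allFin n ∈ listings n
allFin∈listings n = ∈listings⁺ (allFin⁺ n) (List.length-tabulate _)

∈descentWords⇒length : ∀ X {ℓ I} → I ∈ descentWords X ℓ → length I ≡ ℓ
∈descentWords⇒length X {ℓ} I∈ with _ , _ , refl ← ∈.∈-map⁻ _ I∈ = bits-length _ ℓ

size-determined-suc : ∀ {ℓ} (P Q : FinPoset) → U-equal P Q → FinPoset.size P ≡ suc ℓ → FinPoset.size Q ≡ suc ℓ
size-determined-suc {ℓ} P Q U sizeP = trans (coeffU-staircase-positive⁻ (D Q) T positiveQ) (cong suc |T|≡ℓ)
  where
  T : List Bool
  T = bits (XDes (Digraph.edge (D P)) (allFin (FinPoset.size P))) ℓ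
  |T|≡ℓ : length T ≡ ℓ
  |T|≡ℓ = bits-length _ ℓ
  T∈ : T ∈ descentWords (D P) (length T)
  T∈ = subst (λ k → T ∈ descentWords (D P) k) (sym |T|≡ℓ) (∈.∈-map⁺ _ (allFin∈listings (FinPoset.size P)))
  positiveP : 0 < coeffUP P (content (staircase T))
  positiveP = subst (0 <_) (sym (coeffU-staircase-count (D P) T (trans sizeP (cong suc (sym |T|≡ℓ)))))
                (∈⇒0<count (descentWords (D P) (length T)) T∈ (⊆ᵇ-refl T))
  positiveQ : 0 < coeffUP Q (content (staircase T))
  positiveQ = subst (0 <_) (U _ (content (staircase T))) positiveP

size-determined : ∀ (P Q : FinPoset) → U-equal P Q → FinPoset.size P ≡ FinPoset.size Q
size-determined P Q U = by-cases (FinPoset.size P) (FinPoset.size Q) refl refl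
  where
  by-cases : ∀ m n → FinPoset.size P ≡ m → FinPoset.size Q ≡ n → FinPoset.size P ≡ FinPoset.size Q
  by-cases zero    zero    sizeP sizeQ = trans sizeP (sym sizeQ)
  by-cases (suc _) _       sizeP _     = trans sizeP (sym (size-determined-suc P Q U sizeP))
  by-cases zero    (suc _) _     sizeQ = trans (size-determined-suc Q P (λ m α → sym (U m α)) sizeQ) (sym sizeQ)

descentWords-⊆-counts : ∀ (P Q : FinPoset) → U-equal P Q → ∀ B →
                        FinPoset.size P ≡ suc (length B) → FinPoset.size Q ≡ suc (length B) →
                        count (_⊆ᵇ B) (descentWords (D P) (length B)) ≡ count (_⊆ᵇ B) (descentWords (D Q) (length B))
descentWords-⊆-counts P Q U B sizeP sizeQ = trans (sym (coeffU-staircase-count (D P) B sizeP))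
  (trans (U _ (content (staircase B))) (coeffU-staircase-count (D Q) B sizeQ))

descentWords-≡-counts : ∀ (P Q : FinPoset) → U-equal P Q → ∀ I →
                        FinPoset.size P ≡ suc (length I) → FinPoset.size Q ≡ suc (length I) →
                        count (λ d → ⌊ d ≟ᵇₗ I ⌋) (descentWords (D P) (length I)) ≡
                        count (λ d → ⌊ d ≟ᵇₗ I ⌋) (descentWords (D Q) (length I))
descentWords-≡-counts P Q U I sizeP sizeQ =
  counts-⊆⇒counts-≡ I (descentWords (D P) (length I)) (descentWords (D Q) (length I)) λ B |B|≡|I| →
  subst (λ k → count (_⊆ᵇ B) (descentWords (D P) k) ≡ count (_⊆ᵇ B) (descentWords (D Q) k)) |B|≡|I|
    (descentWords-⊆-counts P Q U B (trans sizeP (cong suc (sym |B|≡|I|))) (trans sizeQ (cong suc (sym |B|≡|I|))))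

descentWords-agree : ∀ {ℓ} (P Q : FinPoset) → U-equal P Q → FinPoset.size P ≡ suc ℓ → FinPoset.size Q ≡ suc ℓ →
                     ∀ {I} → I ∈ descentWords (D P) ℓ → I ∈ descentWords (D Q) ℓ
descentWords-agree P Q U sizeP sizeQ {I} I∈ with refl ← ∈descentWords⇒length (D P) I∈
  with d , d∈ , d≟I ← 0<count⇒∈ (descentWords (D Q) (length I))
         (subst (0 <_) (descentWords-≡-counts P Q U I sizeP sizeQ) (∈⇒0<count _ I∈ (⌊⌋-true (I ≟ᵇₗ I) refl)))
  = subst (_∈ descentWords (D Q) (length I)) (⌊⌋-true⁻ (d ≟ᵇₗ I) d≟I) d∈

record IsListing (n : ℕ) (p : ℕ → Fin n) : Set where
  field
    injective  : ∀ {i j} → i < n → j < n → p i ≡ p j → i ≡ j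
    surjective : ∀ x → Σ ℕ λ i → i < n × p i ≡ x

  position : Fin n → ℕ
  position x = proj₁ (surjective x)

  position< : ∀ x → position x < n
  position< x = proj₁ (proj₂ (surjective x))

  at-position : ∀ x → p (position x) ≡ x
  at-position x = proj₂ (proj₂ (surjective x))

  position-at : ∀ {i} → i < n → position (p i) ≡ i
  position-at i<n = injective (position< _) i<n (at-position _)

unique⇒listing : ∀ {n} (τ : List (Fin n)) d → Unique τ → length τ ≡ n → IsListing n (nth τ d)
unique⇒listing {n} τ d uniq |τ|≡n = record
  { injective  = λ i<n j<n → nth-injective τ d uniq (subst (_ <_) (sym |τ|≡n) i<n) (subst (_ <_) (sym |τ|≡n) j<n)
  ; surjective = surjective }
  where
  surjective : ∀ x → Σ ℕ λ i → i < n × nth τ d i ≡ x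
  surjective x with i , i< , τᵢ≡x ← ∈⇒nth τ d (Unique-complete τ uniq |τ|≡n x) = i , subst (i <_) |τ|≡n i< , τᵢ≡x

relabel : ∀ {n p q} → IsListing n p → IsListing n q → Fin n ↔ Fin n
relabel {p = p} {q} lp lq = mk↔ₛ′ (q ∘ P.position) (p ∘ Q.position) inverseˡ inverseʳ
  where
  module P = IsListing lp
  module Q = IsListing lq
  inverseˡ : ∀ y → q (P.position (p (Q.position y))) ≡ y
  inverseˡ y = trans (cong q (P.position-at (Q.position< y))) (Q.at-position y)
  inverseʳ : ∀ x → p (Q.position (q (P.position x))) ≡ x
  inverseʳ x = trans (cong p (Q.position-at (P.position< x))) (P.at-position x)

rise : ∀ {n} → (Fin n → Fin n → Bool) → (ℕ → Fin n) → ℕ → Bool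
rise e p k = e (p k) (p (suc k))

RiseRun : ∀ {n} → (Fin n → Fin n → Bool) → (ℕ → Fin n) → ℕ → ℕ → Set
RiseRun e p i j = i ≤ j × (∀ k → i ≤ k → k < j → rise e p k ≡ true)

riseRun-refl : ∀ {n} (e : Fin n → Fin n → Bool) p i → RiseRun e p i i
riseRun-refl e p i = ℕ.≤-refl , λ k i≤k k<i → ⊥-elim (ℕ.<-irrefl refl (ℕ.<-≤-trans k<i i≤k))

riseRun-transfer : ∀ {ℓ} {e₁ e₂ : Fin (suc ℓ) → Fin (suc ℓ) → Bool} {p q} → (∀ k → k < ℓ → rise e₁ p k ≡ rise e₂ q k) →
                   ∀ {i j} → j ≤ ℓ → RiseRun e₁ p i j → RiseRun e₂ q i j
riseRun-transfer same j≤ℓ (i≤j , rises) = i≤j , λ k i≤k k<j → trans (sym (same k (ℕ.<-≤-trans k<j j≤ℓ))) (rises k i≤k k<j)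

XDes-nth : ∀ {n} (e : Fin n → Fin n → Bool) τ d k → suc k < length τ → XDes e τ (suc k) ≡ rise e (nth τ d) k
XDes-nth e (a ∷ b ∷ r) d zero    _        = refl
XDes-nth e (a ∷ b ∷ r) d (suc k) (s≤s k<) = XDes-nth e (b ∷ r) d k k<
XDes-nth e (a ∷ [])    d zero    (s≤s ())
XDes-nth e (a ∷ [])    d (suc k) (s≤s ())

same-word⇒same-rises : ∀ {ℓ} {e₁ e₂ : Fin (suc ℓ) → Fin (suc ℓ) → Bool} {τ σ} →
                       length τ ≡ suc ℓ → length σ ≡ suc ℓ → bits (XDes e₁ τ) ℓ ≡ bits (XDes e₂ σ) ℓ →
                       ∀ k → k < ℓ → rise e₁ (nth τ zero) k ≡ rise e₂ (nth σ zero) k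
same-word⇒same-rises {e₁ = e₁} {e₂} {τ} {σ} |τ| |σ| same k k<ℓ = begin
  rise e₁ (nth τ zero) k ≡⟨ XDes-nth e₁ τ zero k (subst (suc k <_) (sym |τ|) (s≤s k<ℓ)) ⟨
  XDes e₁ τ (suc k)      ≡⟨ bits-injective (XDes e₁ τ) (XDes e₂ σ) _ same k k<ℓ ⟩
  XDes e₂ σ (suc k)      ≡⟨ XDes-nth e₂ σ zero k (subst (suc k <_) (sym |σ|) (s≤s k<ℓ)) ⟩
  rise e₂ (nth σ zero) k ∎
  where open ≡-Reasoning

nth-Linked : ∀ {R : A → A → Set} {xs} d → Linked R xs → ∀ {k} → suc k < length xs → R (nth xs d k) (nth xs d (suc k))
nth-Linked d (r ∷ _)      {zero}  _        = r
nth-Linked d (_ ∷ linked) {suc k} (s≤s k<) = nth-Linked d linked k<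
nth-Linked d [-]          {_}     (s≤s ())

-- Rebuilding a poset from its fields makes its size definitionally suc ℓ; by η for
-- records, posetOn applied to the fields of P is P itself.
posetOn : ∀ {n} {_≼_ : Fin n → Fin n → Set} → IsPartialOrder _≡_ _≼_ → Decidable _≼_ → FinPoset
posetOn {n} {_≼_} isPartialOrder _≼?_ = record { size = n ; _≤_ = _≼_ ; isPartialOrder = isPartialOrder ; _≤?_ = _≼?_ }

module Chains {ℓ : ℕ} {_≼_ : Fin (suc ℓ) → Fin (suc ℓ) → Set}
              (isPartialOrder : IsPartialOrder _≡_ _≼_) (_≼?_ : Decidable _≼_)
              (chains : IsDisjointUnionOfChains (posetOn isPartialOrder _≼?_)) where

  open IsPartialOrder isPartialOrder using (antisym) renaming (refl to ≼-refl; trans to ≼-trans)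

  n : ℕ
  n = suc ℓ

  P : FinPoset
  P = posetOn isPartialOrder _≼?_

  block : Fin n → ℕ
  block = proj₁ chains

  e : Fin n → Fin n → Bool
  e = Digraph.edge (D P)

  edge⇒≼ : ∀ {x y} → e x y ≡ true → x ≼ y
  edge⇒≼ {x} {y} exy = ⌊⌋-true⁻ (x ≼? y) (proj₁ (∧-true⁻ exy))

  ≼⇒edge : ∀ {x y} → x ≼ y → x ≢ y → e x y ≡ true
  ≼⇒edge {x} {y} x≼y x≢y rewrite ⌊⌋-true (x ≼? y) x≼y | ⌊⌋-false (x Fin.≟ y) x≢y = refl

  ≼⇒same-block : ∀ {x y} → x ≼ y → block x ≡ block y
  ≼⇒same-block {x} {y} x≼y with block x ℕ.≟ block y
  ... | yes same   = same
  ... | no  differ = ⊥-elim (proj₂ (proj₂ chains) x y differ x≼y)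

  blockSeen : (ℕ → Fin n) → ℕ → Bool
  blockSeen p j = any< j (λ i → ⌊ block (p i) ℕ.≟ block (p j) ⌋)

  newBlocks nonRises : (ℕ → Fin n) → ℕ
  newBlocks p = sum< ℓ (λ k → 𝟙 (not (blockSeen p (suc k))))
  nonRises  p = sum< ℓ (λ k → 𝟙 (not (rise e p k)))

  firstBlocks : (ℕ → Fin n) → ℕ → List ℕ
  firstBlocks p zero    = []
  firstBlocks p (suc j) = if blockSeen p j then firstBlocks p j else block (p j) ∷ firstBlocks p j

  firstBlocks-length : ∀ p j → length (firstBlocks p j) ≡ sum< j (λ i → 𝟙 (not (blockSeen p i)))
  firstBlocks-length p zero    = refl
  firstBlocks-length p (suc j) with blockSeen p j
  ... | true  = firstBlocks-length p j
  ... | false = cong suc (firstBlocks-length p j)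

  ∈firstBlocks⁻ : ∀ p j {b} → b ∈ firstBlocks p j → Σ ℕ λ i → i < j × block (p i) ≡ b
  ∈firstBlocks⁻ p (suc j) b∈ with blockSeen p j | b∈
  ... | false | here refl = j , ℕ.≤-refl , refl
  ... | false | there b∈′ with i , i<j , same ← ∈firstBlocks⁻ p j b∈′ = i , ℕ.m<n⇒m<1+n i<j , same
  ... | true  | b∈′       with i , i<j , same ← ∈firstBlocks⁻ p j b∈′ = i , ℕ.m<n⇒m<1+n i<j , same

  firstBlocks-complete : ∀ p j {i} → i < j → block (p i) ∈ firstBlocks p j
  firstBlocks-complete p (suc j) {i} i<1+j with ℕ.m≤n⇒m<n∨m≡n (ℕ.≤-pred i<1+j)
  ... | inj₁ i<j  = kept (blockSeen p j) (firstBlocks-complete p j i<j)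
    where
    kept : ∀ b {x y : ℕ} {l} → x ∈ l → x ∈ (if b then l else y ∷ l)
    kept true  x∈ = x∈
    kept false x∈ = there x∈
  ... | inj₂ refl with blockSeen p i in seen
  ...   | false = here refl
  ...   | true with i′ , i′<i , same ← any<-true⁻ i _ seen =
    subst (_∈ firstBlocks p i) (⌊⌋-true⁻ (block (p i′) ℕ.≟ block (p i)) same) (firstBlocks-complete p i i′<i)

  firstBlocks-unique : ∀ p j → Unique (firstBlocks p j)
  firstBlocks-unique p zero    = []
  firstBlocks-unique p (suc j) with blockSeen p j in seen
  ... | true  = firstBlocks-unique p j
  ... | false = All.tabulate fresh ∷ firstBlocks-unique p j
    where
    fresh : ∀ {b} → b ∈ firstBlocks p j → block (p j) ≢ b
    fresh b∈ refl with i , i<j , same ← ∈firstBlocks⁻ p j b∈ =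
      contradiction (trans (sym seen) (any<-true j _ i<j (⌊⌋-true (block (p i) ℕ.≟ block (p j)) same))) λ ()

  firstBlocks-⊆ : ∀ {p q} → IsListing n q → ∀ {b} → b ∈ firstBlocks p n → b ∈ firstBlocks q n
  firstBlocks-⊆ {p} {q} lq b∈ with i , i<n , refl ← ∈firstBlocks⁻ p n b∈ =
    subst (λ x → block x ∈ firstBlocks q n) (IsListing.at-position lq (p i)) (firstBlocks-complete q n (IsListing.position< lq (p i)))

  suc-newBlocks : ∀ p → suc (newBlocks p) ≡ length (firstBlocks p n)
  suc-newBlocks p = sym (trans (firstBlocks-length p n) (sum<-suc ℓ _))

  newBlocks-invariant : ∀ {p q} → IsListing n p → IsListing n q → newBlocks p ≡ newBlocks q
  newBlocks-invariant {p} {q} lp lq = ℕ.suc-injective (begin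
    suc (newBlocks p)          ≡⟨ suc-newBlocks p ⟩
    length (firstBlocks p n)   ≡⟨ ℕ.≤-antisym (Unique-⊆⇒length-≤ (firstBlocks-unique p n) (firstBlocks-⊆ lq))
                                              (Unique-⊆⇒length-≤ (firstBlocks-unique q n) (firstBlocks-⊆ lp)) ⟩
    length (firstBlocks q n)   ≡⟨ suc-newBlocks q ⟨
    suc (newBlocks q)          ∎)
    where open ≡-Reasoning

  rise⇒blockSeen : ∀ p k → rise e p k ≡ true → blockSeen p (suc k) ≡ true
  rise⇒blockSeen p k r = any<-true (suc k) _ ℕ.≤-refl
    (⌊⌋-true (block (p k) ℕ.≟ block (p (suc k))) (≼⇒same-block (edge⇒≼ r)))

  newBlock≤nonRise : ∀ p k → 𝟙 (not (blockSeen p (suc k))) ≤ 𝟙 (not (rise e p k))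
  newBlock≤nonRise p k with rise e p k in r
  ... | false = 𝟙≤1 (not (blockSeen p (suc k)))
    where
    𝟙≤1 : ∀ b → 𝟙 b ≤ 1
    𝟙≤1 true  = ℕ.≤-refl
    𝟙≤1 false = z≤n
  ... | true rewrite rise⇒blockSeen p k r = z≤n

  newBlocks≤nonRises : ∀ p → newBlocks p ≤ nonRises p
  newBlocks≤nonRises p = sum<-mono ℓ _ _ (λ k _ → newBlock≤nonRise p k)

  Tight : (ℕ → Fin n) → Set
  Tight p = ∀ k → k < ℓ → rise e p k ≡ false → blockSeen p (suc k) ≡ false

  tight⇒nonRises≤newBlocks : ∀ p → Tight p → nonRises p ≤ newBlocks p
  tight⇒nonRises≤newBlocks p tight = sum<-mono ℓ _ _ nonRise≤new
    where
    nonRise≤new : ∀ k → k < ℓ → 𝟙 (not (rise e p k)) ≤ 𝟙 (not (blockSeen p (suc k)))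
    nonRise≤new k k<ℓ with rise e p k in r
    ... | true  = z≤n
    ... | false rewrite tight k k<ℓ r = ℕ.≤-refl

  nonRises≤newBlocks⇒tight : ∀ p → nonRises p ≤ newBlocks p → Tight p
  nonRises≤newBlocks⇒tight p nonRises≤ k k<ℓ r = unseen (blockSeen p (suc k)) (trans pointwise (cong (𝟙 ∘ not) r))
    where
    pointwise : 𝟙 (not (blockSeen p (suc k))) ≡ 𝟙 (not (rise e p k))
    pointwise = sum<-tight ℓ _ _ (λ k _ → newBlock≤nonRise p k) (ℕ.≤-antisym (newBlocks≤nonRises p) nonRises≤) k k<ℓ
    unseen : ∀ b → 𝟙 (not b) ≡ 1 → b ≡ false
    unseen false _ = refl

  riseRun⇒≼ : ∀ p {i j} → RiseRun e p i j → p i ≼ p j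
  riseRun⇒≼ p {i} {zero}  (z≤n , _) = ≼-refl
  riseRun⇒≼ p {i} {suc j} (i≤1+j , rises) with ℕ.m≤n⇒m<n∨m≡n i≤1+j
  ... | inj₂ refl  = ≼-refl
  ... | inj₁ i<1+j = ≼-trans (riseRun⇒≼ p (ℕ.≤-pred i<1+j , λ k i≤k k<j → rises k i≤k (ℕ.m<n⇒m<1+n k<j)))
                             (edge⇒≼ (rises j (ℕ.≤-pred i<1+j) ℕ.≤-refl))

  tight⇒riseRun : ∀ p → Tight p → ∀ {i j} → i ≤ j → j < n → block (p i) ≡ block (p j) → RiseRun e p i j
  tight⇒riseRun p tight {i} {zero}  z≤n    _     _    = riseRun-refl e p 0
  tight⇒riseRun p tight {i} {suc j} i≤1+j 1+j<n same with ℕ.m≤n⇒m<n∨m≡n i≤1+j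
  ... | inj₂ refl  = riseRun-refl e p i
  ... | inj₁ i<1+j = i≤1+j , rises
    where
    last : rise e p j ≡ true
    last with rise e p j in r
    ... | true  = refl
    ... | false = contradiction (any<-true (suc j) _ i<1+j (⌊⌋-true (block (p i) ℕ.≟ block (p (suc j))) same))
                                (λ seen → contradiction (trans (sym (tight j (ℕ.≤-pred 1+j<n) r)) seen) λ ())
    run : RiseRun e p i j
    run = tight⇒riseRun p tight (ℕ.≤-pred i<1+j) (ℕ.<-trans (ℕ.n<1+n j) 1+j<n)
            (trans same (sym (≼⇒same-block (edge⇒≼ last))))
    rises : ∀ k → i ≤ k → k < suc j → rise e p k ≡ true
    rises k i≤k k<1+j with ℕ.m≤n⇒m<n∨m≡n (ℕ.≤-pred k<1+j)
    ... | inj₁ k<j  = proj₂ run k i≤k k<j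
    ... | inj₂ refl = last

  ≼⇒riseRun : ∀ {p} → IsListing n p → Tight p → ∀ {i j} → i < n → j < n → p i ≼ p j → RiseRun e p i j
  ≼⇒riseRun {p} lp tight {i} {j} i<n j<n pᵢ≼pⱼ with ℕ.≤-total i j
  ... | inj₁ i≤j = tight⇒riseRun p tight i≤j j<n (≼⇒same-block pᵢ≼pⱼ)
  ... | inj₂ j≤i = subst (RiseRun e p i) (IsListing.injective lp i<n j<n pᵢ≡pⱼ) (riseRun-refl e p i)
    where
    pᵢ≡pⱼ : p i ≡ p j
    pᵢ≡pⱼ = antisym pᵢ≼pⱼ (riseRun⇒≼ p (tight⇒riseRun p tight j≤i i<n (sym (≼⇒same-block pᵢ≼pⱼ))))

  _⊑_ : Fin n → Fin n → Set
  x ⊑ y = block x < block y ⊎ (block x ≡ block y × x ≼ y)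

  ⊑-isDecTotalOrder : IsDecTotalOrder _≡_ _⊑_
  ⊑-isDecTotalOrder = record
    { isTotalOrder = record
      { isPartialOrder = record
        { isPreorder = record
          { isEquivalence = PropEq.isEquivalence
          ; reflexive     = λ { refl → inj₂ (refl , ≼-refl) }
          ; trans         = ⊑-trans }
        ; antisym = ⊑-antisym }
      ; total = ⊑-total }
    ; _≟_  = Fin._≟_
    ; _≤?_ = λ x y → (block x ℕ.<? block y) ⊎-dec ((block x ℕ.≟ block y) ×-dec (x ≼? y)) }
    where
    ⊑-trans : ∀ {x y z} → x ⊑ y → y ⊑ z → x ⊑ z
    ⊑-trans (inj₁ x<y)          (inj₁ y<z)          = inj₁ (ℕ.<-trans x<y y<z)
    ⊑-trans {x} (inj₁ x<y)       (inj₂ (y≡z , _))    = inj₁ (subst (block x <_) y≡z x<y)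
    ⊑-trans {z = z} (inj₂ (x≡y , _)) (inj₁ y<z)      = inj₁ (subst (_< block z) (sym x≡y) y<z)
    ⊑-trans (inj₂ (x≡y , x≼y))  (inj₂ (y≡z , y≼z))  = inj₂ (trans x≡y y≡z , ≼-trans x≼y y≼z)
    ⊑-antisym : ∀ {x y} → x ⊑ y → y ⊑ x → x ≡ y
    ⊑-antisym (inj₁ x<y)         (inj₁ y<x)         = ⊥-elim (ℕ.<-asym x<y y<x)
    ⊑-antisym (inj₁ x<y)         (inj₂ (y≡x , _))   = ⊥-elim (ℕ.<-irrefl (sym y≡x) x<y)
    ⊑-antisym (inj₂ (x≡y , _))   (inj₁ y<x)         = ⊥-elim (ℕ.<-irrefl (sym x≡y) y<x)
    ⊑-antisym (inj₂ (_ , x≼y))   (inj₂ (_ , y≼x))   = antisym x≼y y≼x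
    ⊑-total : ∀ x y → x ⊑ y ⊎ y ⊑ x
    ⊑-total x y with ℕ.<-cmp (block x) (block y)
    ... | tri< x<y _ _ = inj₁ (inj₁ x<y)
    ... | tri> _ _ y<x = inj₂ (inj₁ y<x)
    ... | tri≈ _ same _ with proj₁ (proj₂ chains) x y same
    ...   | inj₁ x≼y = inj₁ (inj₂ (same , x≼y))
    ...   | inj₂ y≼x = inj₂ (inj₂ (sym same , y≼x))

  open import Data.List.Relation.Binary.Permutation.Setoid.Properties (PropEq.setoid (Fin n)) using (Unique-resp-↭)
  ⊑-decTotalOrder : DecTotalOrder 0ℓ 0ℓ 0ℓ
  ⊑-decTotalOrder = record { isDecTotalOrder = ⊑-isDecTotalOrder }

  open import Data.List.Sort ⊑-decTotalOrder using (sort; sort-↗; sort-↭)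

  sortedElements : List (Fin n)
  sortedElements = sort (allFin n)

  sortedElements-unique : Unique sortedElements
  sortedElements-unique = Unique-resp-↭ (↭⇒↭ₛ (↭-sym (sort-↭ (allFin n)))) (allFin⁺ n)

  sortedElements-length : length sortedElements ≡ n
  sortedElements-length = trans (↭-length (sort-↭ (allFin n))) (List.length-tabulate (λ i → i))

  p★ : ℕ → Fin n
  p★ = nth sortedElements zero

  p★-listing : IsListing n p★
  p★-listing = unique⇒listing sortedElements zero sortedElements-unique sortedElements-length

  sortedElements∈listings : sortedElements ∈ listings n
  sortedElements∈listings = ∈listings⁺ sortedElements-unique sortedElements-length

  p★-adjacent : ∀ {k} → suc k < n → p★ k ⊑ p★ (suc k)
  p★-adjacent 1+k<n = nth-Linked zero (sort-↗ (allFin n)) (subst (_ <_) (sym sortedElements-length) 1+k<n)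

  ⊑⇒block≤ : ∀ {x y} → x ⊑ y → block x ≤ block y
  ⊑⇒block≤ (inj₁ x<y)        = ℕ.<⇒≤ x<y
  ⊑⇒block≤ (inj₂ (same , _)) = ℕ.≤-reflexive same

  p★-block-mono : ∀ {i j} → i ≤ j → j < n → block (p★ i) ≤ block (p★ j)
  p★-block-mono {i} {zero}  z≤n    _     = ℕ.≤-refl
  p★-block-mono {i} {suc j} i≤1+j 1+j<n with ℕ.m≤n⇒m<n∨m≡n i≤1+j
  ... | inj₂ refl  = ℕ.≤-refl
  ... | inj₁ i<1+j = ℕ.≤-trans (p★-block-mono (ℕ.≤-pred i<1+j) (ℕ.<-trans (ℕ.n<1+n j) 1+j<n)) (⊑⇒block≤ (p★-adjacent 1+j<n))

  p★-tight : Tight p★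
  p★-tight k k<ℓ nonRise = any<-false (suc k) _ λ i i<1+k →
    ⌊⌋-false (block (p★ i) ℕ.≟ block (p★ (suc k)))
      (λ same → ℕ.<-irrefl same (ℕ.≤-<-trans (p★-block-mono (ℕ.≤-pred i<1+k) k<n) climbs))
    where
    k<n : k < n
    k<n = ℕ.m<n⇒m<1+n k<ℓ
    p★k≢p★1+k : p★ k ≢ p★ (suc k)
    p★k≢p★1+k eq = ℕ.1+n≢n (sym (IsListing.injective p★-listing k<n (s≤s k<ℓ) eq))
    climbs : block (p★ k) < block (p★ (suc k))
    climbs with p★-adjacent (s≤s k<ℓ)
    ... | inj₁ k<1+k      = k<1+k
    ... | inj₂ (_ , k≼1+k) = contradiction (trans (sym nonRise) (≼⇒edge k≼1+k p★k≢p★1+k)) λ ()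

  p★-minimal : nonRises p★ ≤ newBlocks p★
  p★-minimal = tight⇒nonRises≤newBlocks p★ p★-tight

  newBlocks★≤nonRises : ∀ {p} → IsListing n p → newBlocks p★ ≤ nonRises p
  newBlocks★≤nonRises {p} lp = ℕ.≤-trans (ℕ.≤-reflexive (newBlocks-invariant p★-listing lp)) (newBlocks≤nonRises p)

  minimal⇒tight : ∀ {p} → IsListing n p → nonRises p ≤ newBlocks p★ → Tight p
  minimal⇒tight {p} lp minimal = nonRises≤newBlocks⇒tight p (ℕ.≤-trans minimal (ℕ.≤-reflexive (newBlocks-invariant p★-listing lp)))

  p★-rises-realised : ∀ {_⊴_ : Fin n → Fin n → Set} (isPartialOrder′ : IsPartialOrder _≡_ _⊴_) (_⊴?_ : Decidable _⊴_) →
                      U-equal P (posetOn isPartialOrder′ _⊴?_) →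
                      Σ (ℕ → Fin n) λ q → IsListing n q ×
                        (∀ k → k < ℓ → rise e p★ k ≡ rise (Digraph.edge (D (posetOn isPartialOrder′ _⊴?_))) q k)
  p★-rises-realised isPartialOrder′ _⊴?_ U
    with σ , σ∈ , same-word ← ∈.∈-map⁻ _ (descentWords-agree P (posetOn isPartialOrder′ _⊴?_) U refl refl
                                           (∈.∈-map⁺ _ sortedElements∈listings))
    with σ-unique , σ-length ← ∈listings⁻ σ∈
    = nth σ zero , unique⇒listing σ zero σ-unique σ-length ,
      same-word⇒same-rises {e₁ = e} {Digraph.edge (D (posetOn isPartialOrder′ _⊴?_))} {sortedElements} {σ}
                           sortedElements-length σ-length same-word

module TwoChains {ℓ : ℕ} {_≼₁_ _≼₂_ : Fin (suc ℓ) → Fin (suc ℓ) → Set}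
  (isPartialOrder₁ : IsPartialOrder _≡_ _≼₁_) (_≼₁?_ : Decidable _≼₁_)
  (chains₁ : IsDisjointUnionOfChains (posetOn isPartialOrder₁ _≼₁?_))
  (isPartialOrder₂ : IsPartialOrder _≡_ _≼₂_) (_≼₂?_ : Decidable _≼₂_)
  (chains₂ : IsDisjointUnionOfChains (posetOn isPartialOrder₂ _≼₂?_)) where

  module C₁ = Chains isPartialOrder₁ _≼₁?_ chains₁
  module C₂ = Chains isPartialOrder₂ _≼₂?_ chains₂

  SameRises : (ℕ → Fin (suc ℓ)) → (ℕ → Fin (suc ℓ)) → Set
  SameRises p q = ∀ k → k < ℓ → rise C₁.e p k ≡ rise C₂.e q k

  same-rises⇒same-nonRises : ∀ {p q} → SameRises p q → C₁.nonRises p ≡ C₂.nonRises q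
  same-rises⇒same-nonRises same = sum<-cong ℓ _ _ (λ k k<ℓ → cong (𝟙 ∘ not) (same k k<ℓ))

  tight-listings⇒isomorphic : ∀ {p q} → IsListing (suc ℓ) p → IsListing (suc ℓ) q → C₁.Tight p → C₂.Tight q →
                              SameRises p q → Isomorphic C₁.P C₂.P
  tight-listings⇒isomorphic {p} {q} lp lq tight-p tight-q same = relabel lp lq , λ x y → mk⇔ (preserves x y) (reflects x y)
    where
    open IsListing lp using (position; position<; at-position)
    preserves : ∀ x y → x ≼₁ y → q (position x) ≼₂ q (position y)
    preserves x y x≼y = C₂.riseRun⇒≼ q (riseRun-transfer {e₁ = C₁.e} {C₂.e} {p} {q} same (ℕ.≤-pred (position< y))
      (C₁.≼⇒riseRun lp tight-p (position< x) (position< y) (subst₂ _≼₁_ (sym (at-position x)) (sym (at-position y)) x≼y)))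
    reflects : ∀ x y → q (position x) ≼₂ q (position y) → x ≼₁ y
    reflects x y qx≼qy = subst₂ _≼₁_ (at-position x) (at-position y) (C₁.riseRun⇒≼ p
      (riseRun-transfer {e₁ = C₂.e} {C₁.e} {q} {p} (λ k k<ℓ → sym (same k k<ℓ)) (ℕ.≤-pred (position< y))
        (C₂.≼⇒riseRun lq tight-q (position< x) (position< y) qx≼qy)))

  matched-listing-tight : ∀ {σ ρ} → IsListing (suc ℓ) σ → IsListing (suc ℓ) ρ →
                          SameRises C₁.p★ σ → SameRises ρ C₂.p★ → C₂.Tight σ
  matched-listing-tight {σ} {ρ} lσ lρ σ-rises ρ-rises = C₂.minimal⇒tight lσ (begin
    C₂.nonRises σ       ≡⟨ same-rises⇒same-nonRises σ-rises ⟨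
    C₁.nonRises C₁.p★   ≤⟨ C₁.p★-minimal ⟩
    C₁.newBlocks C₁.p★  ≤⟨ C₁.newBlocks★≤nonRises lρ ⟩
    C₁.nonRises ρ       ≡⟨ same-rises⇒same-nonRises ρ-rises ⟩
    C₂.nonRises C₂.p★   ≤⟨ C₂.p★-minimal ⟩
    C₂.newBlocks C₂.p★  ∎)
    where open ℕ.≤-Reasoning

  isomorphic : U-equal C₁.P C₂.P → Isomorphic C₁.P C₂.P
  isomorphic U
    with σ , lσ , σ-rises ← C₁.p★-rises-realised isPartialOrder₂ _≼₂?_ U
    with ρ , lρ , ρ-rises ← C₂.p★-rises-realised isPartialOrder₁ _≼₁?_ (λ m α → sym (U m α))
    = tight-listings⇒isomorphic C₁.p★-listing lσ C₁.p★-tight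
        (matched-listing-tight lσ lρ σ-rises (λ k k<ℓ → sym (ρ-rises k k<ℓ))) σ-rises

chains-isomorphic : ∀ (P Q : FinPoset) → IsDisjointUnionOfChains P → IsDisjointUnionOfChains Q → U-equal P Q →
                    FinPoset.size P ≡ FinPoset.size Q → Isomorphic P Q
chains-isomorphic record { size = zero } record { size = zero } _ _ _ _ =
  mk↔ₛ′ (λ ()) (λ ()) (λ ()) (λ ()) , λ ()
chains-isomorphic record { size = suc _ ; isPartialOrder = isPartialOrder₁ ; _≤?_ = _≼₁?_ }
                  record { size = suc _ ; isPartialOrder = isPartialOrder₂ ; _≤?_ = _≼₂?_ } chains₁ chains₂ U refl =
  TwoChains.isomorphic isPartialOrder₁ _≼₁?_ chains₁ isPartialOrder₂ _≼₂?_ chains₂ U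

mainTheorem14 : (P Q : FinPoset) → IsDisjointUnionOfChains P → IsDisjointUnionOfChains Q → U-equal P Q → Isomorphic P Q
mainTheorem14 P Q chainsP chainsQ U = chains-isomorphic P Q chainsP chainsQ U (size-determined P Q U)
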